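{- For a prime power $q$ and an integer $\delta\ge 2$ let $$L(q,\delta)=q^{2\delta(\delta+1)}+(q^{2\delta}-1)\begin{bmatrix} 2\delta \\ \delta \end{bmatrix}_q+q^{(\lfloor\delta/2\rfloor+1)\delta}+q^{\delta}+1,\qquad U(q,\delta)=q^{2\delta(\delta+1)}+(q^{2\delta}+q^{\delta})\begin{bmatrix} 2\delta \\ \delta \end{bmatrix}_q+1.$$ Then for every prime power $q$ and every $\delta\ge2$, $\dfrac{L(q,\delta)}{U(q,\delta)}\geq \dfrac{4642}{4797}>0.967688$, and for every prime power $q$ and every $\delta\geq 3$, $\dfrac{L(q,\delta)}{U(q,\delta)}\geq \dfrac{16865174}{16877657}>0.99926$.
   Context: $\begin{bmatrix} n\\ k\end{bmatrix}_q=\prod_{i=0}^{k-1}\frac{q^{n-i}-1}{q^{k-i}-1}$ is the Gaussian binomial coefficient. (These $L$ and $U$ are respectively a lower and an upper bound on the maximum size of a $(4\delta,2\delta,2\delta)_q$ constant dimension code containing a lifted MRD code.) -}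

module Defs where

open import Data.Nat using (ℕ; zero; suc; _+_; _*_; _∸_; _^_; _/_; _≤_; _<_; NonZero; ≢-nonZero; _≟_)
open import Data.Nat.Primality using (Prime)
open import Data.Product using (Σ; _×_; ∃; ∃-syntax)
open import Relation.Binary.PropositionalEquality using (_≡_)
open import Relation.Nullary using (yes; no)

IsPrimePower : ℕ → Set
IsPrimePower q = ∃[ p ] ∃[ k ] (Prime p × 1 ≤ k × q ≡ p ^ k)

gNum : ℕ → ℕ → ℕ → ℕ
gNum q n zero    = 1
gNum q n (suc i) = gNum q n i * (q ^ (n ∸ i) ∸ 1)

gDen' : ℕ → ℕ → ℕ → ℕ
gDen' q k zero    = 1
gDen' q k (suc i) = gDen' q k i * (q ^ (k ∸ i) ∸ 1)

gDen : ℕ → ℕ → ℕ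
gDen q k = gDen' q k k

-- Gaussian binomial coefficient [n k]_q = ∏_{i=0}^{k-1} (q^{n-i}-1)/(q^{k-i}-1)
-- (the quotient is exact for q ≥ 2; the fallback 0 only occurs when the
-- denominator vanishes, i.e. q = 1 and k ≥ 1, which never arises for prime powers)
gauss : ℕ → ℕ → ℕ → ℕ
gauss q n k with gDen q k ≟ 0
... | yes _ = 0
... | no d≢0 = _/_ (gNum q n k) (gDen q k) {{≢-nonZero d≢0}}

half : ℕ → ℕ
half zero = zero
half (suc zero) = zero
half (suc (suc n)) = suc (half n)

L : ℕ → ℕ → ℕ
L q δ = q ^ (2 * δ * (δ + 1)) + (q ^ (2 * δ) ∸ 1) * gauss q (2 * δ) δ
        + q ^ ((half δ + 1) * δ) + q ^ δ + 1

U : ℕ → ℕ → ℕ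
U q δ = q ^ (2 * δ * (δ + 1)) + (q ^ (2 * δ) + q ^ δ) * gauss q (2 * δ) δ + 1

module Submission where

-- Write y = q^δ, so that q^(2δ) = y², and G for the Gaussian binomial. With c = b − a,
-- a·U ≤ b·L follows from a·(y + 1)·G ≤ c·(y² − 1)·G, the only other terms of U being
-- matched by those of L; so it holds once a·(y + 1) ≤ c·(y² − 1), i.e. for q^δ beyond
-- a threshold (31, resp. 1353). The finitely many prime powers q and δ with q^δ below
-- the threshold are checked by evaluation.

open import Defs
open import Data.Nat
  using (ℕ; suc; _+_; _*_; _∸_; _^_; _≤_; _<_; _≤?_; _<?_; NonZero; >-nonZero; nonTrivial⇒n>1; allUpTo?)
open import Data.Nat.Properties
open import Data.Nat.Primality using (prime⇒nonZero; prime⇒nonTrivial)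
open import Data.Nat.Tactic.RingSolver using (solve-∀)
open import Data.Product using (_×_; _,_)
open import Data.Unit using (tt)
open import Relation.Binary.PropositionalEquality using (_≡_; refl; sym; cong; subst; module ≡-Reasoning)
open import Relation.Nullary using (Dec; yes; no)
open import Relation.Nullary.Decidable using (_×-dec_; _→-dec_; from-yes)

RatioAtLeast : ℕ → ℕ → ℕ → ℕ → Set
RatioAtLeast a b q δ = a * U q δ ≤ b * L q δ

U-shape≤L-shape : ∀ a c {A G z} y x → 1 ≤ x → a * suc y + c ≤ c * x →
                  a * (A + (x + y) * G + 1) ≤ (a + c) * (A + (x ∸ 1) * G + z + y + 1)
U-shape≤L-shape a c {A} {G} {z} y (suc x) _ h = begin
    a * (A + (suc x + y) * G + 1)
  ≡⟨ expand a A G y x ⟩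
    a * A + (a * x * G + a * suc y * G) + a
  ≤⟨ +-monoˡ-≤ a (+-monoʳ-≤ (a * A) (+-monoʳ-≤ (a * x * G) (*-monoˡ-≤ G a[1+y]≤cx))) ⟩
    a * A + (a * x * G + c * x * G) + a
  ≤⟨ m≤m+n _ (c * A + (a + c) * (z + y) + c) ⟩
    (a * A + (a * x * G + c * x * G) + a) + (c * A + (a + c) * (z + y) + c)
  ≡⟨ collect a c A G z y x ⟩
    (a + c) * (A + x * G + z + y + 1)
  ∎
  where
  open ≤-Reasoning
  expand : ∀ a A G y x → a * (A + (suc x + y) * G + 1) ≡ a * A + (a * x * G + a * suc y * G) + a
  expand = solve-∀
  collect : ∀ a c A G z y x →
            (a * A + (a * x * G + c * x * G) + a) + (c * A + (a + c) * (z + y) + c)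
            ≡ (a + c) * (A + x * G + z + y + 1)
  collect = solve-∀
  a[1+y]≤cx : a * suc y ≤ c * x
  a[1+y]≤cx = +-cancelˡ-≤ c _ _ (begin
    c + a * suc y ≡⟨ +-comm c _ ⟩
    a * suc y + c ≤⟨ h ⟩
    c * suc x     ≡⟨ *-suc c x ⟩
    c + c * x     ∎)

linear≤quadratic-upward : ∀ a c T → a * suc T + c ≤ c * (T * T) → a ≤ c * T + c * T →
                          ∀ y → T ≤ y → a * suc y + c ≤ c * (y * y)
linear≤quadratic-upward a c T base slope y T≤y with m≤n⇒∃[o]m+o≡n T≤y
... | t , refl = begin
    a * suc (T + t) + c
  ≡⟨ split a c T t ⟩
    (a * suc T + c) + a * t
  ≤⟨ +-mono-≤ base (≤-trans (*-monoˡ-≤ t slope) (m≤m+n _ _)) ⟩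
    c * (T * T) + ((c * T + c * T) * t + c * t * t)
  ≡⟨ square c T t ⟩
    c * ((T + t) * (T + t))
  ∎
  where
  open ≤-Reasoning
  split : ∀ a c T t → a * suc (T + t) + c ≡ (a * suc T + c) + a * t
  split = solve-∀
  square : ∀ a T t → a * (T * T) + ((a * T + a * T) * t + a * t * t) ≡ a * ((T + t) * (T + t))
  square = solve-∀

^-double : ∀ q n → q ^ (2 * n) ≡ q ^ n * q ^ n
^-double q n = begin
  q ^ (2 * n)   ≡⟨ cong (λ m → q ^ (n + m)) (+-identityʳ n) ⟩
  q ^ (n + n)   ≡⟨ ^-distribˡ-+-* q n n ⟩
  q ^ n * q ^ n ∎
  where open ≡-Reasoning

ratio-bound-for-large-q^δ : ∀ a c T q δ .{{_ : NonZero q}} →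
                            a * suc T + c ≤ c * (T * T) → a ≤ c * T + c * T →
                            T ≤ q ^ δ → RatioAtLeast a (a + c) q δ
ratio-bound-for-large-q^δ a c T q δ base slope T≤qᵟ =
  U-shape≤L-shape a c (q ^ δ) (q ^ (2 * δ)) (m^n>0 q (2 * δ)) dominated
  where
  dominated : a * suc (q ^ δ) + c ≤ c * q ^ (2 * δ)
  dominated = subst (λ x → a * suc (q ^ δ) + c ≤ c * x) (sym (^-double q δ))
                (linear≤quadratic-upward a c T base slope (q ^ δ) T≤qᵟ)

prime-power⇒2≤ : ∀ {q} → IsPrimePower q → 2 ≤ q
prime-power⇒2≤ (p , k , p-prime , 1≤k , refl) = begin
  2     ≤⟨ nonTrivial⇒n>1 p {{prime⇒nonTrivial p-prime}} ⟩
  p     ≡⟨ sym (^-identityʳ p) ⟩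
  p ^ 1 ≤⟨ ^-monoʳ-≤ p {{prime⇒nonZero p-prime}} 1≤k ⟩
  p ^ k ∎
  where open ≤-Reasoning

SmallCase : ℕ → ℕ → ℕ → ℕ → Set
SmallCase δ₀ T q δ = 2 ≤ q × δ₀ ≤ δ × q ^ δ < T

small-case? : ∀ δ₀ T q δ → Dec (SmallCase δ₀ T q δ)
small-case? δ₀ T q δ = 2 ≤? q ×-dec δ₀ ≤? δ ×-dec q ^ δ <? T

small-case-bounded : ∀ {δ₀ T q δ} Q D → T ≤ Q ^ δ₀ → T ≤ 2 ^ D →
                     SmallCase δ₀ T q δ → q < Q × δ < D
small-case-bounded {δ₀} {T} {q} {δ} Q D T≤Q^δ₀ T≤2^D (2≤q , δ₀≤δ , q^δ<T) =
  ≰⇒> (λ Q≤q → <⇒≱ q^δ<T (≤-trans T≤Q^δ₀ (≤-trans (^-monoˡ-≤ δ₀ Q≤q) (^-monoʳ-≤ q δ₀≤δ)))) ,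
  ≰⇒> (λ D≤δ → <⇒≱ q^δ<T (≤-trans T≤2^D (≤-trans (^-monoʳ-≤ 2 D≤δ) (^-monoˡ-≤ δ 2≤q))))
  where instance _ = >-nonZero (<⇒≤ 2≤q)

SmallCasesVerified : ℕ → ℕ → ℕ → ℕ → ℕ → ℕ → Set
SmallCasesVerified a b δ₀ T Q D =
  ∀ {q} → q < Q → ∀ {δ} → δ < D → SmallCase δ₀ T q δ → RatioAtLeast a b q δ

small-cases-verified? : ∀ a b δ₀ T Q D → Dec (SmallCasesVerified a b δ₀ T Q D)
small-cases-verified? a b δ₀ T Q D =
  allUpTo? {P = λ q → ∀ {δ} → δ < D → SmallCase δ₀ T q δ → RatioAtLeast a b q δ}
    (λ q → allUpTo? {P = λ δ → SmallCase δ₀ T q δ → RatioAtLeast a b q δ}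
             (λ δ → small-case? δ₀ T q δ →-dec a * U q δ ≤? b * L q δ) D) Q

ratio-bound-for-prime-powers :
  ∀ a c T δ₀ Q D → a * suc T + c ≤ c * (T * T) → a ≤ c * T + c * T →
  T ≤ Q ^ δ₀ → T ≤ 2 ^ D → SmallCasesVerified a (a + c) δ₀ T Q D →
  ∀ q δ → IsPrimePower q → δ₀ ≤ δ → RatioAtLeast a (a + c) q δ
ratio-bound-for-prime-powers a c T δ₀ Q D base slope T≤Q^δ₀ T≤2^D verified q δ q-pp δ₀≤δ =
  by-size (T ≤? q ^ δ)
  where
  2≤q : 2 ≤ q
  2≤q = prime-power⇒2≤ q-pp
  instance _ = >-nonZero (<⇒≤ 2≤q)
  by-size : Dec (T ≤ q ^ δ) → RatioAtLeast a (a + c) q δ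
  by-size (yes T≤q^δ) = ratio-bound-for-large-q^δ a c T q δ base slope T≤q^δ
  by-size (no T≰q^δ)  = let q<Q , δ<D = small-case-bounded Q D T≤Q^δ₀ T≤2^D small
                        in verified q<Q δ<D small
    where
    small : SmallCase δ₀ T q δ
    small = 2≤q , δ₀≤δ , ≰⇒> T≰q^δ

mainTheorem14 : ((q δ : ℕ) → IsPrimePower q → 2 ≤ δ → 4642 * U q δ ≤ 4797 * L q δ)
    × (967688 * 4797 < 4642 * 1000000)
    × ((q δ : ℕ) → IsPrimePower q → 3 ≤ δ → 16865174 * U q δ ≤ 16877657 * L q δ)
    × (99926 * 16877657 < 16865174 * 100000)
mainTheorem14 = ratio≥4642/4797 , ≤ᵇ⇒≤ _ _ tt , ratio≥16865174/16877657 , ≤ᵇ⇒≤ _ _ tt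
  where
  ratio≥4642/4797 : ∀ q δ → IsPrimePower q → 2 ≤ δ → RatioAtLeast 4642 4797 q δ
  ratio≥4642/4797 = ratio-bound-for-prime-powers 4642 155 31 2 6 5
    (≤ᵇ⇒≤ _ _ tt) (≤ᵇ⇒≤ _ _ tt) (≤ᵇ⇒≤ _ _ tt) (≤ᵇ⇒≤ _ _ tt)
    (from-yes (small-cases-verified? 4642 4797 2 31 6 5))
  ratio≥16865174/16877657 : ∀ q δ → IsPrimePower q → 3 ≤ δ → RatioAtLeast 16865174 16877657 q δ
  ratio≥16865174/16877657 = ratio-bound-for-prime-powers 16865174 12483 1353 3 12 11
    (≤ᵇ⇒≤ _ _ tt) (≤ᵇ⇒≤ _ _ tt) (≤ᵇ⇒≤ _ _ tt) (≤ᵇ⇒≤ _ _ tt)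
    (from-yes (small-cases-verified? 16865174 16877657 3 1353 12 11))
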